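{- Let $G$ be a graph, $k\geq 1$ an integer, and $v$ a vertex of $G$. Let $a_1b_1,\dots,a_nb_n$ be a matching in $G-v$ with every $a_i$ adjacent to $v$ that is maximal among such matchings (i.e., it cannot be extended by an edge $ab$ of $G-v$ with $a\in N(v)$ and $a,b$ unmatched), and suppose $n< 4k+2$. Let $M=\{a_1,b_1,\dots,a_n,b_n\}$ and $X=N(v)\setminus M$, and assume $|X|\geq 100k$. If $x\in X$ is such that every neighbor of $x$ in $M$ is good, then $G$ contains $k$ pairwise vertex-disjoint paths with $3$ edges each if and only if $G- vx$ does.
   Context: For $u\in M$, let $X_u=N(u)\cap X$. A vertex $u\in M$ is called good if every set $S\subseteq M$ has the following property: if there is a matching between $S$ and $X_u$ of size $|X_u|-1$, then $S$ has more than $4k$ neighbors in $X$. $G-vx$ denotes $G$ with the edge $vx$ deleted. -}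

module Defs where

open import Data.Nat using (ℕ; zero; suc; _+_; _*_; _<_; _≤_)
open import Data.Bool using (Bool; true; false; _∧_; _∨_; not)
open import Data.Fin using (Fin; zero; suc; _≟_)
open import Data.Fin.Subset using (Subset; _∈_; _⊆_; _∩_; _─_; ∣_∣)
open import Data.Vec using (tabulate)
open import Data.Product using (Σ; _×_; _,_)
open import Relation.Nullary using (¬_)
open import Relation.Nullary.Decidable using (⌊_⌋)
open import Relation.Binary.PropositionalEquality using (_≡_; _≢_)

record Graph (N : ℕ) : Set where
  field
    adj    : Fin N → Fin N → Bool
    symm   : ∀ u w → adj u w ≡ adj w u
    irrefl : ∀ u → adj u u ≡ false
open Graph public

Adj : ∀ {N} → Graph N → Fin N → Fin N → Set
Adj G u w = adj G u w ≡ true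

isPair : ∀ {N} → Fin N → Fin N → Fin N → Fin N → Bool
isPair v x u w = (⌊ u ≟ v ⌋ ∧ ⌊ w ≟ x ⌋) ∨ (⌊ u ≟ x ⌋ ∧ ⌊ w ≟ v ⌋)

deleteEdge : ∀ {N} → Graph N → Fin N → Fin N → Graph N
deleteEdge G v x = record
  { adj = λ u w → adj G u w ∧ not (isPair v x u w)
  ; symm = λ u w → sym-aux u w
  ; irrefl = λ u → irr-aux u }
  where
    open import Data.Bool.Properties using (∨-comm; ∧-comm)
    open import Relation.Binary.PropositionalEquality using (cong₂; cong; refl; trans)
    isPair-sym : ∀ u w → isPair v x u w ≡ isPair v x w u
    isPair-sym u w = trans (∨-comm (⌊ u ≟ v ⌋ ∧ ⌊ w ≟ x ⌋) (⌊ u ≟ x ⌋ ∧ ⌊ w ≟ v ⌋))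
      (cong₂ _∨_ (∧-comm ⌊ u ≟ x ⌋ ⌊ w ≟ v ⌋) (∧-comm ⌊ u ≟ v ⌋ ⌊ w ≟ x ⌋))
    sym-aux : ∀ u w → (adj G u w ∧ not (isPair v x u w)) ≡ (adj G w u ∧ not (isPair v x w u))
    sym-aux u w = cong₂ _∧_ (symm G u w) (cong not (isPair-sym u w))
    irr-aux : ∀ u → (adj G u u ∧ not (isPair v x u u)) ≡ false
    irr-aux u = cong (λ b → b ∧ not (isPair v x u u)) (irrefl G u)

anyFin : ∀ {n} → (Fin n → Bool) → Bool
anyFin {zero}  f = false
anyFin {suc n} f = f zero ∨ anyFin (λ i → f (suc i))

HasDisjointP3s : ∀ {N} → Graph N → ℕ → Set
HasDisjointP3s {N} G k =
  Σ (Fin k → Fin 4 → Fin N) λ p →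
    (∀ i j i' j' → p i j ≡ p i' j' → (i ≡ i') × (j ≡ j'))
    × (∀ i → Adj G (p i zero) (p i (suc zero))
           × Adj G (p i (suc zero)) (p i (suc (suc zero)))
           × Adj G (p i (suc (suc zero))) (p i (suc (suc (suc zero)))))

module Setup {N : ℕ} (G : Graph N) (k : ℕ) (v : Fin N)
             {n : ℕ} (a b : Fin n → Fin N) where

  IsMatching : Set
  IsMatching =
    (∀ i j → a i ≡ a j → i ≡ j) × (∀ i j → b i ≡ b j → i ≡ j)
    × (∀ i j → a i ≢ b j)
    × (∀ i → a i ≢ v) × (∀ i → b i ≢ v)
    × (∀ i → Adj G (a i) (b i)) × (∀ i → Adj G v (a i))

  Nbhd : Fin N → Subset N
  Nbhd u = tabulate (adj G u)

  M : Subset N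
  M = tabulate (λ w → anyFin (λ i → ⌊ a i ≟ w ⌋ ∨ ⌊ b i ≟ w ⌋))

  IsMaximal : Set
  IsMaximal = ∀ a' b' → a' ≢ v → b' ≢ v → Adj G v a' → Adj G a' b' →
              ¬ (a' ∉M × b' ∉M)
    where
      _∉M : Fin N → Set
      w ∉M = ¬ (w ∈ M)

  X : Subset N
  X = Nbhd v ─ M

  Xof : Fin N → Subset N
  Xof u = Nbhd u ∩ X

  NX : Subset N → Subset N
  NX S = X ∩ tabulate (λ w → anyFin (λ s → ⌊ s ∈? S ⌋ ∧ adj G s w))
    where open import Data.Fin.Subset.Properties using (_∈?_)

  MatchingBetween : Subset N → Subset N → ℕ → Set
  MatchingBetween S T m =
    Σ (Fin m → Fin N) λ s → Σ (Fin m → Fin N) λ t →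
      (∀ j → s j ∈ S) × (∀ j → t j ∈ T) × (∀ j → Adj G (s j) (t j))
      × (∀ i j → s i ≡ s j → i ≡ j) × (∀ i j → t i ≡ t j → i ≡ j)
      × (∀ i j → s i ≢ t j)

  -- u is good: every S ⊆ M admitting a matching with X_u of size
  -- |X_u| - 1 (read over the integers: m + 1 = |X_u|) has > 4k
  -- neighbours in X.
  Good : Fin N → Set
  Good u = ∀ (S : Subset N) → S ⊆ M → ∀ (m : ℕ) → m + 1 ≡ ∣ Xof u ∣ →
           MatchingBetween S (Xof u) m → 4 * k < ∣ NX S ∣

-- Given k disjoint 3-edge paths in G, those using the edge vx are rerouted.  Reversing a path if necessary, x is
-- slot 0 or 1 of a path P, and since |X| ≥ 100k > 4k + 1 some vertices of X ⊆ N(v) lie on no path.  If x is an end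
-- of P attached to v, an unused vertex of X replaces x.  If x is interior, its neighbours on P are v and some u, which
-- lies in M by maximality and is therefore good.  Either an unused y ∈ X_u − x replaces x, or the far end c of P lies
-- in X_u and P becomes x u c v, or every y ∈ X_u − x lies on another path.  In the last case the path neighbours of
-- these y form a set S ⊆ M matched to X_u − x, so S has more than 4k neighbours in X and one of them, w, is unused;
-- trading y for w between P and the path through y (via v and a second unused z ∈ X when y is interior) avoids vx.

module Submission where

open import Defs
open import Data.Nat using (ℕ; _+_; _*_; _<_; _≤_)
open import Data.Fin using (Fin)
open import Data.Fin.Subset using (_∈_; ∣_∣)
open import Function.Bundles using (_⇔_)

open import Data.Nat using (suc; s≤s; z≤n)
open import Data.Nat.Properties using (+-comm; *-comm; *-distribʳ-+; *-monoʳ-≤; +-monoˡ-≤; ≤-trans; n≤1+n; <⇒≱; module ≤-Reasoning)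
open import Data.Bool using (Bool; true; false; _∧_)
open import Data.Bool.Properties using (∧-zeroʳ)
open import Data.Fin using (zero; suc; _≟_; opposite; punchIn; combine; remQuot)
open import Data.Fin.Properties using (punchIn-injective; punchInᵢ≢i; injective⇒≤; any?; all?; remQuot-combine; suc-injective)
open import Data.Fin.Subset using (Subset; _∉_; _⊆_; _─_; inside; outside)
open import Data.Fin.Subset.Properties using (_∈?_; p─q⊆p; x∈p∩q⁺; x∈p∩q⁻)
open import Data.Vec using (_∷_; tabulate)
open import Data.Vec.Base using (here; there)
open import Data.Vec.Properties using ([]=⇒lookup; lookup⇒[]=; lookup∘tabulate)
import Data.Vec.Functional as Vector
open import Data.Product using (Σ; _×_; _,_; proj₁; proj₂)
import Data.Product.Properties as ×
open import Data.Sum using (_⊎_; inj₁; inj₂)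
import Data.Sum.Properties as ⊎
open import Data.Empty using (⊥-elim)
open import Function using (_∘_)
open import Function.Bundles using (mk⇔)
open import Function.Definitions using (Injective)
open import Relation.Nullary using (¬_; Dec; yes; no; contradiction)
open import Relation.Nullary.Decidable using (decidable-stable; ⌊_⌋; isYes≗does; dec-true; dec-false; _×-dec_; _→-dec_; ¬?; from-yes)
open import Relation.Binary.PropositionalEquality using (_≡_; _≢_; refl; sym; trans; cong; cong₂; cong-app; subst; subst₂)

pattern 0F = zero
pattern 1F = suc zero
pattern 2F = suc (suc zero)
pattern 3F = suc (suc (suc zero))

Injective₂ : {A B C : Set} → (A → B → C) → Set
Injective₂ f = ∀ i j i′ j′ → f i j ≡ f i′ j′ → i ≡ i′ × j ≡ j′

∈-tabulate⁻ : ∀ {n} (f : Fin n → Bool) {w} → w ∈ tabulate f → f w ≡ true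
∈-tabulate⁻ f {w} w∈ = trans (sym (lookup∘tabulate f w)) ([]=⇒lookup w∈)

∈-tabulate⁺ : ∀ {n} (f : Fin n → Bool) {w} → f w ≡ true → w ∈ tabulate f
∈-tabulate⁺ f {w} fw = lookup⇒[]= w (tabulate f) (trans (lookup∘tabulate f w) fw)

anyFin⁻ : ∀ {n} (f : Fin n → Bool) → anyFin f ≡ true → Σ (Fin n) λ j → f j ≡ true
anyFin⁻ {suc n} f any with f zero in f0
... | true  = zero , f0
... | false with anyFin⁻ (f ∘ suc) any
...   | j , fj = suc j , fj

anyFin⁺ : ∀ {n} (f : Fin n → Bool) j → f j ≡ true → anyFin f ≡ true
anyFin⁺ f zero fj rewrite fj = refl
anyFin⁺ f (suc j) fj with f zero
... | true  = refl
... | false = anyFin⁺ (f ∘ suc) j fj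

x∈p─q⇒x∉q : ∀ {n} (p q : Subset n) {x} → x ∈ p ─ q → x ∉ q
x∈p─q⇒x∉q (inside ∷ p) (outside ∷ q) here ()
x∈p─q⇒x∉q (_ ∷ p) (_ ∷ q) (there x∈p─q) (there x∈q) = x∈p─q⇒x∉q p q x∈p─q x∈q

image : ∀ {m n} → (Fin m → Fin n) → Subset n
image f = tabulate λ w → anyFin λ j → ⌊ f j ≟ w ⌋

∈-image⁺ : ∀ {m n} (f : Fin m → Fin n) j → f j ∈ image f
∈-image⁺ f j = ∈-tabulate⁺ _
  (anyFin⁺ (λ i → ⌊ f i ≟ f j ⌋) j (trans (isYes≗does (f j ≟ f j)) (dec-true (f j ≟ f j) refl)))

∈-image⁻ : ∀ {m n} (f : Fin m → Fin n) {w} → w ∈ image f → Σ (Fin m) λ j → f j ≡ w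
∈-image⁻ f {w} w∈ with anyFin⁻ (λ j → ⌊ f j ≟ w ⌋) (∈-tabulate⁻ _ w∈)
... | j , fj≟w with f j ≟ w
...   | yes fj≡w = j , fj≡w

enumerate : ∀ {n} (p : Subset n) → Fin ∣ p ∣ → Fin n
enumerate (inside ∷ p) zero = zero
enumerate (inside ∷ p) (suc j) = suc (enumerate p j)
enumerate (outside ∷ p) j = suc (enumerate p j)

enumerate-∈ : ∀ {n} (p : Subset n) j → enumerate p j ∈ p
enumerate-∈ (inside ∷ p) zero = here
enumerate-∈ (inside ∷ p) (suc j) = there (enumerate-∈ p j)
enumerate-∈ (outside ∷ p) j = there (enumerate-∈ p j)

enumerate-injective : ∀ {n} (p : Subset n) → Injective _≡_ _≡_ (enumerate p)
enumerate-injective (inside ∷ p) {zero} {zero} _ = refl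
enumerate-injective (inside ∷ p) {suc i} {suc j} e = cong suc (enumerate-injective p (suc-injective e))
enumerate-injective (outside ∷ p) e = enumerate-injective p (suc-injective e)

enumerate-surjective : ∀ {n} (p : Subset n) {x} → x ∈ p → Σ (Fin ∣ p ∣) λ j → enumerate p j ≡ x
enumerate-surjective (inside ∷ p) here = zero , refl
enumerate-surjective (inside ∷ p) (there x∈p) with enumerate-surjective p x∈p
... | j , e = suc j , cong suc e
enumerate-surjective (outside ∷ p) (there x∈p) with enumerate-surjective p x∈p
... | j , e = j , cong suc e

∃-∈-∉-image : ∀ {m n} (g : Fin m → Fin n) (A : Subset n) → m < ∣ A ∣ →
              Σ (Fin n) λ y → y ∈ A × (∀ c → g c ≢ y)
∃-∈-∉-image {m} g A m<∣A∣ with any? (λ y → y ∈? A ×-dec all? (λ c → ¬? (g c ≟ y)))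
... | yes found = found
... | no none = contradiction (injective⇒≤ preimage-injective) (<⇒≱ m<∣A∣)
  where
  covered : ∀ j → Σ (Fin m) λ c → g c ≡ enumerate A j
  covered j with any? (λ c → g c ≟ enumerate A j)
  ... | yes hit = hit
  ... | no miss = ⊥-elim (none (enumerate A j , enumerate-∈ A j , λ c e → miss (c , e)))

  preimage-injective : Injective _≡_ _≡_ (proj₁ ∘ covered)
  preimage-injective {i} {j} e = enumerate-injective A
    (trans (sym (proj₂ (covered i))) (trans (cong g e) (proj₂ (covered j))))

enumerate-except : ∀ {n} (p : Subset n) {x} → x ∈ p →
  Σ ℕ λ m → m + 1 ≡ ∣ p ∣ × Σ (Fin m → Fin n) λ t →
    Injective _≡_ _≡_ t × (∀ j → t j ∈ p) × (∀ j → t j ≢ x)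
enumerate-except {n} p {x} x∈p =
  punch-out (enumerate p) (enumerate-∈ p) (enumerate-injective p) (enumerate-surjective p x∈p)
  where
  punch-out : ∀ {c} (e : Fin c → Fin n) → (∀ j → e j ∈ p) → Injective _≡_ _≡_ e →
    Σ (Fin c) (λ j → e j ≡ x) →
    Σ ℕ λ m → m + 1 ≡ c × Σ (Fin m → Fin n) λ t →
      Injective _≡_ _≡_ t × (∀ j → t j ∈ p) × (∀ j → t j ≢ x)
  punch-out {suc m} e e∈p e-inj (j , ej≡x) =
    m , +-comm m 1 , e ∘ punchIn j ,
    punchIn-injective j _ _ ∘ e-inj ,
    e∈p ∘ punchIn j ,
    λ i e≡x → punchInᵢ≢i j i (e-inj (trans e≡x (sym ej≡x)))

[]-injective : {A : Set} → Injective _≡_ _≡_ (Vector.[] {A = A})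
[]-injective {x = ()}

[-]-injective : {A : Set} (a : A) → Injective _≡_ _≡_ (a Vector.∷ Vector.[])
[-]-injective a {0F} {0F} _ = refl

[-,-]-injective : {A : Set} {a b : A} → a ≢ b → Injective _≡_ _≡_ (a Vector.∷ b Vector.∷ Vector.[])
[-,-]-injective a≢b {0F} {0F} _ = refl
[-,-]-injective a≢b {0F} {1F} a≡b = contradiction a≡b a≢b
[-,-]-injective a≢b {1F} {0F} b≡a = contradiction (sym b≡a) a≢b
[-,-]-injective a≢b {1F} {1F} _ = refl

mate : Fin 4 → Fin 4
mate 0F = 1F
mate 1F = 0F
mate 2F = 3F
mate 3F = 2F

mate-involutive : ∀ l → mate (mate l) ≡ l
mate-involutive 0F = refl
mate-involutive 1F = refl
mate-involutive 2F = refl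
mate-involutive 3F = refl

module _ {N : ℕ} (H : Graph N) where

  Adj-sym : ∀ {a b} → Adj H a b → Adj H b a
  Adj-sym {a} {b} ab = trans (symm H b a) ab

  Adj⇒≢ : ∀ {a b} → Adj H a b → a ≢ b
  Adj⇒≢ {a} aa refl with trans (sym (irrefl H a)) aa
  ... | ()

  IsPath : (Fin 4 → Fin N) → Set
  IsPath P = Adj H (P 0F) (P 1F) × Adj H (P 1F) (P 2F) × Adj H (P 2F) (P 3F)

  mate-adjacent : ∀ {P} → IsPath P → ∀ l → Adj H (P (mate l)) (P l)
  mate-adjacent (e₀₁ , e₁₂ , e₂₃) 0F = Adj-sym e₀₁
  mate-adjacent (e₀₁ , e₁₂ , e₂₃) 1F = e₀₁
  mate-adjacent (e₀₁ , e₁₂ , e₂₃) 2F = Adj-sym e₂₃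
  mate-adjacent (e₀₁ , e₁₂ , e₂₃) 3F = e₂₃

module DeleteEdge {N : ℕ} (G : Graph N) (v x : Fin N) where

  private
    isPair-off-x : ∀ {a b} → a ≢ x → b ≢ x → isPair v x a b ≡ false
    isPair-off-x {a} {b} a≢x b≢x
      rewrite isYes≗does (b ≟ x) | dec-false (b ≟ x) b≢x | isYes≗does (a ≟ x) | dec-false (a ≟ x) a≢x
            | ∧-zeroʳ ⌊ a ≟ v ⌋ = refl

    isPair-off-v : ∀ {a b} → a ≢ v → b ≢ v → isPair v x a b ≡ false
    isPair-off-v {a} {b} a≢v b≢v
      rewrite isYes≗does (a ≟ v) | dec-false (a ≟ v) a≢v | isYes≗does (b ≟ v) | dec-false (b ≟ v) b≢v
            | ∧-zeroʳ ⌊ a ≟ x ⌋ = refl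

  deleteEdge-Adj-off-x : ∀ {a b} → a ≢ x → b ≢ x → Adj G a b → Adj (deleteEdge G v x) a b
  deleteEdge-Adj-off-x a≢x b≢x ab rewrite ab | isPair-off-x a≢x b≢x = refl

  deleteEdge-Adj-off-v : ∀ {a b} → a ≢ v → b ≢ v → Adj G a b → Adj (deleteEdge G v x) a b
  deleteEdge-Adj-off-v a≢v b≢v ab rewrite ab | isPair-off-v a≢v b≢v = refl

  deleteEdge-Adj⁻ : ∀ {a b} → Adj (deleteEdge G v x) a b → Adj G a b
  deleteEdge-Adj⁻ {a} {b} ab with adj G a b
  ... | true = refl

  IsPath-deleteEdge : ∀ {P} → (∀ l → P l ≢ x) → IsPath G P → IsPath (deleteEdge G v x) P
  IsPath-deleteEdge P≢x (e₀₁ , e₁₂ , e₂₃) =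
    deleteEdge-Adj-off-x (P≢x _) (P≢x _) e₀₁ ,
    deleteEdge-Adj-off-x (P≢x _) (P≢x _) e₁₂ ,
    deleteEdge-Adj-off-x (P≢x _) (P≢x _) e₂₃

  HasDisjointP3s-deleteEdge⁻ : ∀ {k} → HasDisjointP3s (deleteEdge G v x) k → HasDisjointP3s G k
  HasDisjointP3s-deleteEdge⁻ (p , disjoint , paths) = p , disjoint , λ i →
    let (e₀₁ , e₁₂ , e₂₃) = paths i
    in deleteEdge-Adj⁻ e₀₁ , deleteEdge-Adj⁻ e₁₂ , deleteEdge-Adj⁻ e₂₃

-- A vertex of a rerouted path: slot l of the j-th replaced path, or the c-th fresh vertex.  Injectivity of a
-- rerouting pattern over this finite type is then decided by computation.
Source : ℕ → ℕ → Set
Source r f = (Fin r × Fin 4) ⊎ Fin f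

slot : ∀ {r f} → Fin r → Fin 4 → Source r f
slot j l = inj₁ (j , l)

new : ∀ {r f} → Fin f → Source r f
new = inj₂

injective₂? : ∀ {r f} (σ : Fin r → Fin 4 → Source r f) → Dec (Injective₂ σ)
injective₂? σ = all? λ i → all? λ l → all? λ i′ → all? λ l′ →
  ⊎.≡-dec (×.≡-dec _≟_ _≟_) _≟_ (σ i l) (σ i′ l′) →-dec (i ≟ i′ ×-dec l ≟ l′)

module _ {N k : ℕ} where

  Avoids : (Fin k → Fin 4 → Fin N) → Fin N → Set
  Avoids p w = ∀ i l → p i l ≢ w

  locate : ∀ p w → (Σ (Fin k) λ i → Σ (Fin 4) λ l → p i l ≡ w) ⊎ Avoids p w
  locate p w with any? (λ i → any? (λ l → p i l ≟ w))
  ... | yes (i , l , e) = inj₁ (i , l , e)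
  ... | no none = inj₂ λ i l e → none (i , l , e)

  avoids? : ∀ p w → Dec (Avoids p w)
  avoids? p w with locate p w
  ... | inj₁ (i , l , e) = no λ avoided → avoided i l e
  ... | inj₂ avoided = yes avoided

  ¬avoids⇒located : ∀ p w → ¬ Avoids p w → Σ (Fin k) λ i → Σ (Fin 4) λ l → p i l ≡ w
  ¬avoids⇒located p w ¬avoided with locate p w
  ... | inj₁ found = found
  ... | inj₂ avoided = contradiction avoided ¬avoided

  flatten : (Fin k → Fin 4 → Fin N) → Fin (k * 4) → Fin N
  flatten p c = p (proj₁ (remQuot {k} 4 c)) (proj₂ (remQuot {k} 4 c))

  avoids-∉-flatten : ∀ p {w} → (∀ c → flatten p c ≢ w) → Avoids p w
  avoids-∉-flatten p ∉flatten i l e =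
    ∉flatten (combine i l) (trans (cong (λ il → p (proj₁ il) (proj₂ il)) (remQuot-combine {k} {4} i l)) e)

  ∃-avoided : ∀ p (A : Subset N) → k * 4 < ∣ A ∣ → Σ (Fin N) λ z → z ∈ A × Avoids p z
  ∃-avoided p A bound with ∃-∈-∉-image (flatten p) A bound
  ... | z , z∈A , z∉ = z , z∈A , avoids-∉-flatten p z∉

  ∃-avoided-≢ : ∀ p (A : Subset N) w → suc (k * 4) < ∣ A ∣ →
                Σ (Fin N) λ z → z ∈ A × Avoids p z × w ≢ z
  ∃-avoided-≢ p A w bound with ∃-∈-∉-image (w Vector.∷ flatten p) A bound
  ... | z , z∈A , z∉ = z , z∈A , avoids-∉-flatten p (z∉ ∘ suc) , z∉ zero

  module Reroute (p : Fin k → Fin 4 → Fin N) {r f} (ι : Fin r → Fin k) (fresh : Fin f → Fin N) where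

    vertex : Source r f → Fin N
    vertex (inj₁ (j , l)) = p (ι j) l
    vertex (inj₂ c) = fresh c

    reroute : (Fin r → Fin 4 → Source r f) → Fin k → Fin 4 → Fin N
    reroute σ i with any? (λ j → ι j ≟ i)
    ... | yes (j , _) = vertex ∘ σ j
    ... | no _ = p i

    reroute-view : ∀ σ i → (Σ (Fin r) λ j → ι j ≡ i × reroute σ i ≡ vertex ∘ σ j)
                         ⊎ ((∀ j → ι j ≢ i) × reroute σ i ≡ p i)
    reroute-view σ i with any? (λ j → ι j ≟ i)
    ... | yes (j , e) = inj₁ (j , e , refl)
    ... | no none = inj₂ ((λ j e → none (j , e)) , refl)

    reroute-at : Injective _≡_ _≡_ ι → ∀ σ j → reroute σ (ι j) ≡ vertex ∘ σ j
    reroute-at ι-injective σ j with reroute-view σ (ι j)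
    ... | inj₂ (off , _) = ⊥-elim (off j refl)
    ... | inj₁ (j′ , ιj′≡ιj , eq) with ι-injective ιj′≡ιj
    ...   | refl = eq

    reroute-paths : ∀ {H} σ → (∀ j → IsPath H (vertex ∘ σ j)) →
                    (∀ i → (∀ j → ι j ≢ i) → IsPath H (p i)) → ∀ i → IsPath H (reroute σ i)
    reroute-paths {H} σ replaced kept i with reroute-view σ i
    ... | inj₁ (j , refl , eq) = subst (IsPath H) (sym eq) (replaced j)
    ... | inj₂ (off , eq) = subst (IsPath H) (sym eq) (kept i off)

    module _ (disjoint : Injective₂ p) (ι-injective : Injective _≡_ _≡_ ι)
             (fresh-injective : Injective _≡_ _≡_ fresh) (fresh-avoided : ∀ c → Avoids p (fresh c)) where

      vertex-injective : Injective _≡_ _≡_ vertex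
      vertex-injective {inj₁ (j , l)} {inj₁ (j′ , l′)} e with disjoint _ _ _ _ e
      ... | ιj≡ιj′ , refl with ι-injective ιj≡ιj′
      ...   | refl = refl
      vertex-injective {inj₁ _} {inj₂ c} e = ⊥-elim (fresh-avoided c _ _ e)
      vertex-injective {inj₂ c} {inj₁ _} e = ⊥-elim (fresh-avoided c _ _ (sym e))
      vertex-injective {inj₂ c} {inj₂ c′} e = cong inj₂ (fresh-injective e)

      vertex-on-replaced : ∀ s i l → p i l ≡ vertex s → Σ (Fin r) λ j → ι j ≡ i
      vertex-on-replaced (inj₁ (j , _)) i l e = j , sym (proj₁ (disjoint _ _ _ _ e))
      vertex-on-replaced (inj₂ c) i l e = ⊥-elim (fresh-avoided c i l e)

      reroute-disjoint : ∀ σ → Injective₂ σ → Injective₂ (reroute σ)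
      reroute-disjoint σ σ-injective i l i′ l′ e with reroute-view σ i | reroute-view σ i′
      ... | inj₁ (j , refl , eq) | inj₁ (j′ , refl , eq′) =
        let j≡j′ , l≡l′ = σ-injective j l j′ l′
              (vertex-injective (trans (sym (cong-app eq l)) (trans e (cong-app eq′ l′))))
        in cong ι j≡j′ , l≡l′
      ... | inj₁ (j , refl , eq) | inj₂ (off′ , eq′) =
        let j′ , ιj′≡i′ = vertex-on-replaced (σ j l) i′ l′
              (trans (sym (cong-app eq′ l′)) (trans (sym e) (cong-app eq l)))
        in ⊥-elim (off′ j′ ιj′≡i′)
      ... | inj₂ (off , eq) | inj₁ (j′ , refl , eq′) =
        let j , ιj≡i = vertex-on-replaced (σ j′ l′) i l
              (trans (sym (cong-app eq l)) (trans e (cong-app eq′ l′)))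
        in ⊥-elim (off j ιj≡i)
      ... | inj₂ (_ , eq) | inj₂ (_ , eq′) =
        disjoint i l i′ l′ (trans (sym (cong-app eq l)) (trans e (cong-app eq′ l′)))

      rerouted : ∀ H σ → Injective₂ σ → (∀ j → IsPath H (vertex ∘ σ j)) →
                 (∀ i → (∀ j → ι j ≢ i) → IsPath H (p i)) → HasDisjointP3s H k
      rerouted H σ σ-injective replaced kept =
        reroute σ , reroute-disjoint σ σ-injective , reroute-paths {H} σ replaced kept

suc[k*4]<100*k : ∀ {k} → 1 ≤ k → suc (k * 4) < 100 * k
suc[k*4]<100*k {k} 1≤k = begin
  2 + k * 4      ≤⟨ +-monoˡ-≤ (k * 4) (≤-trans (s≤s (s≤s z≤n)) (*-monoʳ-≤ 96 1≤k)) ⟩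
  96 * k + k * 4 ≡⟨ cong (96 * k +_) (*-comm k 4) ⟩
  96 * k + 4 * k ≡⟨ sym (*-distribʳ-+ k 96 4) ⟩
  100 * k        ∎
  where open ≤-Reasoning

data Orientation : Set where
  v-x-u u-x-v : Orientation

vSlot uSlot : Orientation → Fin 4
vSlot v-x-u = 0F
vSlot u-x-v = 2F
uSlot v-x-u = 2F
uSlot u-x-v = 0F

uSlot≢vSlot : ∀ o → uSlot o ≢ vSlot o
uSlot≢vSlot v-x-u ()
uSlot≢vSlot u-x-v ()

[_—_—_—_] : {A : Set} → A → A → A → A → Fin 4 → A
[ a — b — c — d ] 0F = a
[ a — b — c — d ] 1F = b
[ a — b — c — d ] 2F = c
[ a — b — c — d ] 3F = d

replaceAt : Fin 4 → Fin 1 → Fin 4 → Source 1 1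
replaceAt l₀ _ l with l ≟ l₀
... | yes _ = new 0F
... | no _ = slot 0F l

replaceAt-injective : ∀ l₀ → Injective₂ (replaceAt l₀)
replaceAt-injective = from-yes (all? λ l₀ → injective₂? (replaceAt l₀))

reversal : Fin 1 → Fin 4 → Source 1 0
reversal _ l = slot 0F (opposite l)

reversal-injective : Injective₂ reversal
reversal-injective = from-yes (injective₂? reversal)

rotation : Orientation → Fin 1 → Fin 4 → Source 1 0
rotation o _ = [ slot 0F 1F — slot 0F (uSlot o) — slot 0F 3F — slot 0F (vSlot o) ]

rotation-injective : ∀ o → Injective₂ (rotation o)
rotation-injective v-x-u = from-yes (injective₂? (rotation v-x-u))
rotation-injective u-x-v = from-yes (injective₂? (rotation u-x-v))

-- y sits at slot l₁ of the second path Q and w (new 0F) is adjacent to its mate.  At an end of Q, y takes the place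
-- of x and w that of y; in the interior of Q, the first path runs along Q to y and on to u and x, while the second
-- leaves Q at the mate of y and runs through w, v and z (new 1F).
exchange : Orientation → Fin 4 → Fin 2 → Fin 4 → Source 2 2
exchange o 0F 0F = [ slot 0F 0F — slot 1F 0F — slot 0F 2F — slot 0F 3F ]
exchange o 0F 1F = [ new 0F — slot 1F 1F — slot 1F 2F — slot 1F 3F ]
exchange o 1F 0F = [ slot 1F 2F — slot 1F 1F — slot 0F (uSlot o) — slot 0F 1F ]
exchange o 1F 1F = [ slot 1F 0F — new 0F — slot 0F (vSlot o) — new 1F ]
exchange o 2F 0F = [ slot 1F 1F — slot 1F 2F — slot 0F (uSlot o) — slot 0F 1F ]
exchange o 2F 1F = [ slot 1F 3F — new 0F — slot 0F (vSlot o) — new 1F ]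
exchange o 3F 0F = [ slot 0F 0F — slot 1F 3F — slot 0F 2F — slot 0F 3F ]
exchange o 3F 1F = [ slot 1F 0F — slot 1F 1F — slot 1F 2F — new 0F ]

exchange-injective : ∀ o l₁ → Injective₂ (exchange o l₁)
exchange-injective v-x-u = from-yes (all? λ l₁ → injective₂? (exchange v-x-u l₁))
exchange-injective u-x-v = from-yes (all? λ l₁ → injective₂? (exchange u-x-v l₁))

module Forward {N : ℕ} (G : Graph N) (k : ℕ) (v : Fin N) {n : ℕ} (a b : Fin n → Fin N)
  (maximal : Setup.IsMaximal G k v a b)
  (X-large : suc (k * 4) < ∣ Setup.X G k v a b ∣)
  (x : Fin N) (x∈X : x ∈ Setup.X G k v a b)
  (neighbours-good : ∀ u → u ∈ Setup.M G k v a b → Adj G x u → Setup.Good G k v a b u) where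

  open Setup G k v a b

  open DeleteEdge G v x

  G′ : Graph N
  G′ = deleteEdge G v x

  X⇒Adj-v : ∀ {y} → y ∈ X → Adj G v y
  X⇒Adj-v y∈X = ∈-tabulate⁻ (adj G v) (p─q⊆p (Nbhd v) M y∈X)

  X⇒∉M : ∀ {y} → y ∈ X → y ∉ M
  X⇒∉M = x∈p─q⇒x∉q (Nbhd v) M

  X⇒≢v : ∀ {y} → y ∈ X → y ≢ v
  X⇒≢v y∈X y≡v = Adj⇒≢ G (X⇒Adj-v y∈X) (sym y≡v)

  x≢v : x ≢ v
  x≢v = X⇒≢v x∈X

  X-neighbour-∈M : ∀ {y w} → y ∈ X → Adj G y w → w ≢ v → w ∈ M
  X-neighbour-∈M {y} {w} y∈X yw w≢v = decidable-stable (w ∈? M) λ w∉M →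
    maximal y w (X⇒≢v y∈X) w≢v (X⇒Adj-v y∈X) yw (X⇒∉M y∈X , w∉M)

  Xof⁻ : ∀ {u y} → y ∈ Xof u → Adj G u y × y ∈ X
  Xof⁻ {u} y∈Xu = let y∈Nu , y∈X = x∈p∩q⁻ (Nbhd u) X y∈Xu in ∈-tabulate⁻ (adj G u) y∈Nu , y∈X

  Xof⁺ : ∀ {u y} → Adj G u y → y ∈ X → y ∈ Xof u
  Xof⁺ {u} uy y∈X = x∈p∩q⁺ (∈-tabulate⁺ (adj G u) uy , y∈X)

  NX⁻ : ∀ {S w} → w ∈ NX S → w ∈ X × Σ (Fin N) λ s → s ∈ S × Adj G s w
  NX⁻ {S} {w} w∈NX with x∈p∩q⁻ X _ w∈NX
  ... | w∈X , w∈N with anyFin⁻ (λ s → ⌊ s ∈? S ⌋ ∧ adj G s w) (∈-tabulate⁻ _ w∈N)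
  ...   | s , found with s ∈? S
  ...     | yes s∈S = w∈X , s , s∈S , found

  module Through (p : Fin k → Fin 4 → Fin N) (disjoint : Injective₂ p) (paths : ∀ i → IsPath G (p i))
                 (i₀ : Fin k) (l₀ : Fin 4) (x-at : p i₀ l₀ ≡ x) where

    off-i₀-≢x : ∀ i → i ≢ i₀ → ∀ l → p i l ≢ x
    off-i₀-≢x i i≢i₀ l e = i≢i₀ (proj₁ (disjoint i l i₀ l₀ (trans e (sym x-at))))

    off-l₀-≢x : ∀ l → l ≢ l₀ → p i₀ l ≢ x
    off-l₀-≢x l l≢l₀ e = l≢l₀ (proj₂ (disjoint i₀ l i₀ l₀ (trans e (sym x-at))))

    edge₀₁ : Adj G (p i₀ 0F) (p i₀ 1F)
    edge₀₁ = proj₁ (paths i₀)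

    edge₁₂ : Adj G (p i₀ 1F) (p i₀ 2F)
    edge₁₂ = proj₁ (proj₂ (paths i₀))

    edge₂₃ : Adj G (p i₀ 2F) (p i₀ 3F)
    edge₂₃ = proj₂ (proj₂ (paths i₀))

    edge-to-uSlot : ∀ o → Adj G (p i₀ 1F) (p i₀ (uSlot o))
    edge-to-uSlot v-x-u = edge₁₂
    edge-to-uSlot u-x-v = Adj-sym G edge₀₁

    avoided⇒≢x : ∀ {z} → Avoids p z → z ≢ x
    avoided⇒≢x avoided z≡x = avoided i₀ l₀ (trans x-at (sym z≡x))

    keep : IsPath G′ (p i₀) → HasDisjointP3s G′ k
    keep path₀ = p , disjoint , paths′
      where
      paths′ : ∀ i → IsPath G′ (p i)
      paths′ i with i ≟ i₀
      ... | yes refl = path₀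
      ... | no i≢i₀ = IsPath-deleteEdge (off-i₀-≢x i i≢i₀) (paths i)

    rerouted-in-G′ : ∀ {r f} (ι : Fin (suc r) → Fin k) → ι 0F ≡ i₀ → Injective _≡_ _≡_ ι →
      (fresh : Fin f → Fin N) → Injective _≡_ _≡_ fresh → (∀ c → Avoids p (fresh c)) →
      (σ : Fin (suc r) → Fin 4 → Source (suc r) f) → Injective₂ σ →
      (∀ j → IsPath G′ (Reroute.vertex p ι fresh ∘ σ j)) → HasDisjointP3s G′ k
    rerouted-in-G′ ι ι0≡i₀ ι-injective fresh fresh-injective fresh-avoided σ σ-injective new-paths =
      Reroute.rerouted p ι fresh disjoint ι-injective fresh-injective fresh-avoided G′ σ σ-injective new-paths
        λ i untouched →
          IsPath-deleteEdge (off-i₀-≢x i λ i≡i₀ → untouched 0F (trans ι0≡i₀ (sym i≡i₀))) (paths i)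

  module Endpoint (p : Fin k → Fin 4 → Fin N) (disjoint : Injective₂ p) (paths : ∀ i → IsPath G (p i))
                  (i₀ : Fin k) (x-at : p i₀ 0F ≡ x) where
    open Through p disjoint paths i₀ 0F x-at

    p₁≢x : p i₀ 1F ≢ x
    p₁≢x = off-l₀-≢x 1F λ ()

    p₂≢x : p i₀ 2F ≢ x
    p₂≢x = off-l₀-≢x 2F λ ()

    p₃≢x : p i₀ 3F ≢ x
    p₃≢x = off-l₀-≢x 3F λ ()

    bypass : HasDisjointP3s G′ k
    bypass with p i₀ 1F ≟ v
    ... | no p₁≢v = keep
      ( deleteEdge-Adj-off-v (x≢v ∘ trans (sym x-at)) p₁≢v edge₀₁
      , deleteEdge-Adj-off-x p₁≢x p₂≢x edge₁₂
      , deleteEdge-Adj-off-x p₂≢x p₃≢x edge₂₃ )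
    ... | yes p₁≡v = let z , z∈X , z-avoided = ∃-avoided p X (≤-trans (n≤1+n _) X-large) in
      rerouted-in-G′ (i₀ Vector.∷ Vector.[]) refl ([-]-injective i₀)
        (z Vector.∷ Vector.[]) ([-]-injective z) (λ { 0F → z-avoided })
        (replaceAt 0F) (replaceAt-injective 0F)
        λ { 0F →
          deleteEdge-Adj-off-x (avoided⇒≢x z-avoided) p₁≢x
            (subst (Adj G z) (sym p₁≡v) (Adj-sym G (X⇒Adj-v z∈X)))
        , deleteEdge-Adj-off-x p₁≢x p₂≢x edge₁₂
        , deleteEdge-Adj-off-x p₂≢x p₃≢x edge₂₃ }

  module Inner (p : Fin k → Fin 4 → Fin N) (disjoint : Injective₂ p) (paths : ∀ i → IsPath G (p i))
               (i₀ : Fin k) (x-at : p i₀ 1F ≡ x)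
               (o : Orientation) (u : Fin N) (v-at : p i₀ (vSlot o) ≡ v) (u-at : p i₀ (uSlot o) ≡ u) where
    open Through p disjoint paths i₀ 1F x-at

    x-adj-u : Adj G x u
    x-adj-u = subst₂ (Adj G) x-at u-at (edge-to-uSlot o)

    u≢v : u ≢ v
    u≢v u≡v = uSlot≢vSlot o
      (proj₂ (disjoint i₀ (uSlot o) i₀ (vSlot o) (trans u-at (trans u≡v (sym v-at)))))

    u∈M : u ∈ M
    u∈M = X-neighbour-∈M x∈X x-adj-u u≢v

    p₀≢x : p i₀ 0F ≢ x
    p₀≢x = off-l₀-≢x 0F λ ()

    p₁≢v : p i₀ 1F ≢ v
    p₁≢v = x≢v ∘ trans (sym x-at)

    p₂≢x : p i₀ 2F ≢ x
    p₂≢x = off-l₀-≢x 2F λ ()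

    p₃≢x : p i₀ 3F ≢ x
    p₃≢x = off-l₀-≢x 3F λ ()

    pᵤ≢x : p i₀ (uSlot o) ≢ x
    pᵤ≢x pᵤ≡x = Adj⇒≢ G x-adj-u (trans (sym pᵤ≡x) u-at)

    pᵤ≢v : p i₀ (uSlot o) ≢ v
    pᵤ≢v = u≢v ∘ trans (sym u-at)

    pᵥ≢x : p i₀ (vSlot o) ≢ x
    pᵥ≢x pᵥ≡x = x≢v (trans (sym pᵥ≡x) v-at)

    uSlot-adj : ∀ {y} → y ∈ Xof u → Adj G (p i₀ (uSlot o)) y
    uSlot-adj y∈Xu = subst (λ w → Adj G w _) (sym u-at) (proj₁ (Xof⁻ y∈Xu))

    vSlot-adj : ∀ {y} → y ∈ X → Adj G (p i₀ (vSlot o)) y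
    vSlot-adj y∈X = subst (λ w → Adj G w _) (sym v-at) (X⇒Adj-v y∈X)

    Flank : Fin N → Set
    Flank w = w ≡ u ⊎ w ≡ v

    flanks : ∀ o′ → p i₀ (vSlot o′) ≡ v → p i₀ (uSlot o′) ≡ u → Flank (p i₀ 0F) × Flank (p i₀ 2F)
    flanks v-x-u v-at′ u-at′ = inj₂ v-at′ , inj₁ u-at′
    flanks u-x-v v-at′ u-at′ = inj₁ u-at′ , inj₂ v-at′

    flank₀ : Flank (p i₀ 0F)
    flank₀ = proj₁ (flanks o v-at u-at)

    flank₂ : Flank (p i₀ 2F)
    flank₂ = proj₂ (flanks o v-at u-at)

    flank-adj : ∀ {w y} → Flank w → y ∈ Xof u → Adj G w y
    flank-adj (inj₁ refl) y∈Xu = proj₁ (Xof⁻ y∈Xu)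
    flank-adj (inj₂ refl) y∈Xu = X⇒Adj-v (proj₂ (Xof⁻ y∈Xu))

    flank-≢ : ∀ {w y} → Flank w → y ∈ X → w ≢ y
    flank-≢ (inj₁ refl) y∈X u≡y = X⇒∉M y∈X (subst (_∈ M) u≡y u∈M)
    flank-≢ (inj₂ refl) y∈X v≡y = X⇒≢v y∈X (sym v≡y)

    via-y : ∀ {y} → y ∈ Xof u → y ≢ x → IsPath G′ [ p i₀ 0F — y — p i₀ 2F — p i₀ 3F ]
    via-y y∈Xu y≢x =
        deleteEdge-Adj-off-x p₀≢x y≢x (flank-adj flank₀ y∈Xu)
      , deleteEdge-Adj-off-x y≢x p₂≢x (Adj-sym G (flank-adj flank₂ y∈Xu))
      , deleteEdge-Adj-off-x p₂≢x p₃≢x edge₂₃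

    rotate : p i₀ 3F ∈ Xof u → HasDisjointP3s G′ k
    rotate c∈Xu = rerouted-in-G′ (i₀ Vector.∷ Vector.[]) refl ([-]-injective i₀)
      Vector.[] []-injective (λ ()) (rotation o) (rotation-injective o)
      λ { 0F → deleteEdge-Adj-off-v p₁≢v pᵤ≢v (edge-to-uSlot o)
             , deleteEdge-Adj-off-x pᵤ≢x p₃≢x (uSlot-adj c∈Xu)
             , deleteEdge-Adj-off-x p₃≢x pᵥ≢x (Adj-sym G (vSlot-adj (proj₂ (Xof⁻ c∈Xu)))) }

    substitute : ∀ {y} → y ∈ Xof u → Avoids p y → HasDisjointP3s G′ k
    substitute {y} y∈Xu y-avoided = rerouted-in-G′ (i₀ Vector.∷ Vector.[]) refl ([-]-injective i₀)
      (y Vector.∷ Vector.[]) ([-]-injective y) (λ { 0F → y-avoided })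
      (replaceAt 1F) (replaceAt-injective 1F)
      λ { 0F → via-y y∈Xu (avoided⇒≢x y-avoided) }

    module Exchange (i₁ : Fin k) (i₀≢i₁ : i₀ ≢ i₁) {w z : Fin N}
                    (w∈X : w ∈ X) (w-avoided : Avoids p w) (z∈X : z ∈ X) (z-avoided : Avoids p z)
                    (w≢z : w ≢ z) where

      q≢x : ∀ l → p i₁ l ≢ x
      q≢x = off-i₀-≢x i₁ (i₀≢i₁ ∘ sym)

      w≢x : w ≢ x
      w≢x = avoided⇒≢x w-avoided

      q-edges : IsPath G′ (p i₁)
      q-edges = IsPath-deleteEdge q≢x (paths i₁)

      via-u : ∀ {l l′} → Adj G (p i₁ l′) (p i₁ l) → p i₁ l ∈ Xof u →
              IsPath G′ [ p i₁ l′ — p i₁ l — p i₀ (uSlot o) — p i₀ 1F ]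
      via-u {l} {l′} q-edge y∈Xu =
          deleteEdge-Adj-off-x (q≢x l′) (q≢x l) q-edge
        , deleteEdge-Adj-off-x (q≢x l) pᵤ≢x (Adj-sym G (uSlot-adj y∈Xu))
        , deleteEdge-Adj-off-v pᵤ≢v p₁≢v (Adj-sym G (edge-to-uSlot o))

      via-v : ∀ {l} → Adj G (p i₁ l) w → IsPath G′ [ p i₁ l — w — p i₀ (vSlot o) — z ]
      via-v {l} mate-w =
          deleteEdge-Adj-off-x (q≢x l) w≢x mate-w
        , deleteEdge-Adj-off-x w≢x pᵥ≢x (Adj-sym G (vSlot-adj w∈X))
        , deleteEdge-Adj-off-x pᵥ≢x (avoided⇒≢x z-avoided) (vSlot-adj z∈X)

      ι : Fin 2 → Fin k
      ι = i₀ Vector.∷ i₁ Vector.∷ Vector.[]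

      fresh : Fin 2 → Fin N
      fresh = w Vector.∷ z Vector.∷ Vector.[]

      new-paths : ∀ l₁ → p i₁ l₁ ∈ Xof u → Adj G (p i₁ (mate l₁)) w →
                  ∀ j → IsPath G′ (Reroute.vertex p ι fresh ∘ exchange o l₁ j)
      new-paths 0F y∈Xu mate-w 0F = via-y y∈Xu (q≢x 0F)
      new-paths 0F y∈Xu mate-w 1F =
        deleteEdge-Adj-off-x w≢x (q≢x 1F) (Adj-sym G mate-w) , proj₂ q-edges
      new-paths 1F y∈Xu mate-w 0F = via-u (Adj-sym G (proj₁ (proj₂ (paths i₁)))) y∈Xu
      new-paths 1F y∈Xu mate-w 1F = via-v mate-w
      new-paths 2F y∈Xu mate-w 0F = via-u (proj₁ (proj₂ (paths i₁))) y∈Xu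
      new-paths 2F y∈Xu mate-w 1F = via-v mate-w
      new-paths 3F y∈Xu mate-w 0F = via-y y∈Xu (q≢x 3F)
      new-paths 3F y∈Xu mate-w 1F =
        proj₁ q-edges , proj₁ (proj₂ q-edges) , deleteEdge-Adj-off-x (q≢x 2F) w≢x mate-w

      exchanged : ∀ l₁ → p i₁ l₁ ∈ Xof u → Adj G (p i₁ (mate l₁)) w → HasDisjointP3s G′ k
      exchanged l₁ y∈Xu mate-w = rerouted-in-G′ ι refl ([-,-]-injective i₀≢i₁)
        fresh ([-,-]-injective w≢z) (λ { 0F → w-avoided ; 1F → z-avoided })
        (exchange o l₁) (exchange-injective o l₁) (new-paths l₁ y∈Xu mate-w)

    off-i₀ : ∀ {y} → p i₀ 3F ∉ Xof u → y ∈ Xof u → y ≢ x → ∀ l → p i₀ l ≢ y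
    off-i₀ c∉Xu y∈Xu y≢x 0F = flank-≢ flank₀ (proj₂ (Xof⁻ y∈Xu))
    off-i₀ c∉Xu y∈Xu y≢x 1F p₁≡y = y≢x (trans (sym p₁≡y) x-at)
    off-i₀ c∉Xu y∈Xu y≢x 2F = flank-≢ flank₂ (proj₂ (Xof⁻ y∈Xu))
    off-i₀ c∉Xu y∈Xu y≢x 3F p₃≡y = c∉Xu (subst (_∈ Xof u) (sym p₃≡y) y∈Xu)

    module AllUsed (c∉Xu : p i₀ 3F ∉ Xof u) {m : ℕ} (m+1≡∣Xu∣ : m + 1 ≡ ∣ Xof u ∣)
                   (t : Fin m → Fin N) (t-injective : Injective _≡_ _≡_ t)
                   (t∈Xu : ∀ j → t j ∈ Xof u) (t≢x : ∀ j → t j ≢ x)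
                   (located : ∀ j → Σ (Fin k) λ i → Σ (Fin 4) λ l → p i l ≡ t j) where

      row : Fin m → Fin k
      row j = proj₁ (located j)

      col : Fin m → Fin 4
      col j = proj₁ (proj₂ (located j))

      at : ∀ j → p (row j) (col j) ≡ t j
      at j = proj₂ (proj₂ (located j))

      row≢i₀ : ∀ j → row j ≢ i₀
      row≢i₀ j refl = off-i₀ c∉Xu (t∈Xu j) (t≢x j) (col j) (at j)

      s : Fin m → Fin N
      s j = p (row j) (mate (col j))

      s-adj-t : ∀ j → Adj G (s j) (t j)
      s-adj-t j = subst (Adj G (s j)) (at j) (mate-adjacent G {p (row j)} (paths (row j)) (col j))

      s∈M : ∀ j → s j ∈ M
      s∈M j = X-neighbour-∈M (proj₂ (Xof⁻ (t∈Xu j))) (Adj-sym G (s-adj-t j))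
        λ sj≡v → row≢i₀ j (proj₁ (disjoint _ _ _ _ (trans sj≡v (sym v-at))))

      s-injective : Injective _≡_ _≡_ s
      s-injective {i} {j} si≡sj = t-injective (trans (sym (at i)) (trans (cong₂ p rows cols) (at j)))
        where
        rows : row i ≡ row j
        rows = proj₁ (disjoint _ _ _ _ si≡sj)
        cols : col i ≡ col j
        cols = trans (sym (mate-involutive (col i)))
                 (trans (cong mate (proj₂ (disjoint _ _ _ _ si≡sj))) (mate-involutive (col j)))

      S⊆M : image s ⊆ M
      S⊆M w∈S = let j , sj≡w = ∈-image⁻ s w∈S in subst (_∈ M) sj≡w (s∈M j)

      matching : MatchingBetween (image s) (Xof u) m
      matching = s , t , ∈-image⁺ s , t∈Xu , s-adj-t , (λ _ _ → s-injective) , (λ _ _ → t-injective) ,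
        λ i j si≡tj → X⇒∉M (proj₂ (Xof⁻ (t∈Xu j))) (subst (_∈ M) si≡tj (s∈M i))

      exchanged-somewhere : HasDisjointP3s G′ k
      exchanged-somewhere =
        let 4k<∣NX∣ = neighbours-good u u∈M x-adj-u (image s) S⊆M m m+1≡∣Xu∣ matching
            w , w∈NX , w-avoided =
              ∃-avoided p (NX (image s)) (subst (_< ∣ NX (image s) ∣) (*-comm 4 k) 4k<∣NX∣)
            w∈X , s′ , s′∈S , s′-adj-w = NX⁻ w∈NX
            j , sj≡s′ = ∈-image⁻ s s′∈S
            z , z∈X , z-avoided , w≢z = ∃-avoided-≢ p X w X-large
        in Exchange.exchanged (row j) (row≢i₀ j ∘ sym) w∈X w-avoided z∈X z-avoided w≢z (col j)
             (subst (_∈ Xof u) (sym (at j)) (t∈Xu j)) (subst (λ q → Adj G q w) (sym sj≡s′) s′-adj-w)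

    detour : HasDisjointP3s G′ k
    detour with p i₀ 3F ∈? Xof u
    ... | yes c∈Xu = rotate c∈Xu
    ... | no c∉Xu with enumerate-except (Xof u) (Xof⁺ (Adj-sym G x-adj-u) x∈X)
    ...   | m , m+1≡∣Xu∣ , t , t-injective , t∈Xu , t≢x with any? (λ j → avoids? p (t j))
    ...     | yes (j , tj-avoided) = substitute (t∈Xu j) tj-avoided
    ...     | no none = AllUsed.exchanged-somewhere c∉Xu m+1≡∣Xu∣ t t-injective t∈Xu t≢x
                          λ j → ¬avoids⇒located p (t j) λ tj-avoided → none (j , tj-avoided)

  from-inner : ∀ p → Injective₂ p → (∀ i → IsPath G (p i)) → ∀ i₀ → p i₀ 1F ≡ x →
               HasDisjointP3s G′ k
  from-inner p disjoint paths i₀ x-at with p i₀ 0F ≟ v | p i₀ 2F ≟ v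
  ... | yes p₀≡v | _ = Inner.detour p disjoint paths i₀ x-at v-x-u (p i₀ 2F) p₀≡v refl
  ... | no _ | yes p₂≡v = Inner.detour p disjoint paths i₀ x-at u-x-v (p i₀ 0F) p₂≡v refl
  ... | no p₀≢v | no p₂≢v = keep
    ( deleteEdge-Adj-off-v p₀≢v p₁≢v edge₀₁
    , deleteEdge-Adj-off-v p₁≢v p₂≢v edge₁₂
    , deleteEdge-Adj-off-x (off-l₀-≢x 2F λ ()) (off-l₀-≢x 3F λ ()) edge₂₃ )
    where
    open Through p disjoint paths i₀ 1F x-at
    p₁≢v : p i₀ 1F ≢ v
    p₁≢v = x≢v ∘ trans (sym x-at)

  reverse-path : ∀ p → Injective₂ p → (∀ i → IsPath G (p i)) → ∀ i₀ →
    Σ (Fin k → Fin 4 → Fin N) λ q →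
      Injective₂ q × (∀ i → IsPath G (q i)) × (∀ l → q i₀ l ≡ p i₀ (opposite l))
  reverse-path p disjoint paths i₀ =
    reroute reversal ,
    reroute-disjoint disjoint ι-injective []-injective (λ ()) reversal reversal-injective ,
    reroute-paths {G} reversal
      (λ _ → let e₀₁ , e₁₂ , e₂₃ = paths i₀ in Adj-sym G e₂₃ , Adj-sym G e₁₂ , Adj-sym G e₀₁)
      (λ i _ → paths i) ,
    cong-app (reroute-at ι-injective reversal 0F)
    where
    ι : Fin 1 → Fin k
    ι = i₀ Vector.∷ Vector.[]
    ι-injective : Injective _≡_ _≡_ ι
    ι-injective = [-]-injective i₀
    open Reroute p ι Vector.[]

  HasDisjointP3s-deleteEdge⁺ : HasDisjointP3s G k → HasDisjointP3s G′ k
  HasDisjointP3s-deleteEdge⁺ (p , disjoint , paths) with locate p x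
  ... | inj₂ x-avoided = p , disjoint , λ i → IsPath-deleteEdge (x-avoided i) (paths i)
  ... | inj₁ (i₀ , 0F , x-at) = Endpoint.bypass p disjoint paths i₀ x-at
  ... | inj₁ (i₀ , 1F , x-at) = from-inner p disjoint paths i₀ x-at
  ... | inj₁ (i₀ , 2F , x-at) = let q , q-disjoint , q-paths , q-at = reverse-path p disjoint paths i₀ in
    from-inner q q-disjoint q-paths i₀ (trans (q-at 1F) x-at)
  ... | inj₁ (i₀ , 3F , x-at) = let q , q-disjoint , q-paths , q-at = reverse-path p disjoint paths i₀ in
    Endpoint.bypass q q-disjoint q-paths i₀ (trans (q-at 0F) x-at)

lemma20 : ∀ {N : ℕ} (G : Graph N) (k : ℕ) → 1 ≤ k → (v : Fin N)
    (n : ℕ) (a b : Fin n → Fin N) →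
    Setup.IsMatching G k v a b → Setup.IsMaximal G k v a b →
    n < 4 * k + 2 → 100 * k ≤ ∣ Setup.X G k v a b ∣ →
    (x : Fin N) → x ∈ Setup.X G k v a b →
    (∀ u → u ∈ Setup.M G k v a b → Adj G x u → Setup.Good G k v a b u) →
    HasDisjointP3s G k ⇔ HasDisjointP3s (deleteEdge G v x) k
lemma20 G k 1≤k v n a b _ maximal _ X-large x x∈X neighbours-good =
  mk⇔ (Forward.HasDisjointP3s-deleteEdge⁺ G k v a b maximal (≤-trans (suc[k*4]<100*k 1≤k) X-large)
         x x∈X neighbours-good)
      (DeleteEdge.HasDisjointP3s-deleteEdge⁻ G v x)
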